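{- Let $\lambda$ be a partition with $r$ parts, $\rho=(r-1,\dots,0)$, $\Theta\in\{\Gamma,\Delta\}^r$, $\Theta'=(\Theta_1,\dots,\Theta_{r-1})$ and $\mathfrak T\in\mathrm{GTP}^{\Theta'}_{\lambda+\rho}$ with entries $a_{i,j}$. If $\mathfrak s=\iota_\Theta^{ -1}(\mathfrak T)\in\mathfrak S^\Theta_{\lambda+\rho}$, then \[ \mathrm{wt}(\mathfrak s)(\mathbf z)=\mathbf z^{w_0\mathrm{wt}(\mathfrak T)}=\prod_{t=1}^r z_t^{\,d_{t-1}-d_t}, \] where $d_i=\sum_{j=i}^{r-1}a_{i,j}$ for $0\le i\le r-1$, $d_r=0$, $\mathrm{wt}(\mathfrak T)=(d_{r-1},d_{r-2}-d_{r-1},\dots,d_0-d_1)$ and $w_0$ reverses the order of an $r$-tuple.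
   Context: Palette $\mathcal P=\{c_1<\dots<c_m\}$; fix $\kappa\in\mathcal P^r$ and an integer $N\ge\lambda_1+r$. Fused crystal vertices: left/right and top/bottom edges each carry $\varnothing$ or one colour. Configurations (left, top, right, bottom), row parameter $z$, unlisted weight $0$. Gamma: $(\varnothing,\varnothing,\varnothing,\varnothing)\mapsto1$; $(c_i,c_j,c_i,c_j)\mapsto0$ if $i<j$, $z$ if $i\ge j$; $(c_i,c_j,c_j,c_i)\mapsto z$ if $i<j$, $0$ if $i>j$; $(\varnothing,c_i,\varnothing,c_i)\mapsto0$; $(c_i,\varnothing,c_i,\varnothing)\mapsto z$; $(c_i,\varnothing,\varnothing,c_i)\mapsto z$; $(\varnothing,c_i,c_i,\varnothing)\mapsto1$. Delta: $(\varnothing,\varnothing,\varnothing,\varnothing)\mapsto z$; $(c_i,c_j,c_i,c_j)\mapsto1$ if $i\le j$, $0$ if $i>j$; $(c_j,c_j,c_i,c_i)\mapsto0$ if $i<j$, $1$ if $i>j$; $(\varnothing,c_i,\varnothing,c_i)\mapsto0$; $(c_i,\varnothing,c_i,\varnothing)\mapsto1$; $(\varnothing,\varnothing,c_i,c_i)\mapsto z$; $(c_i,c_i,\varnothing,\varnothing)\mapsto1$. Lattice: rows $1..r$ top to bottom, $N$ columns numbered $0..N-1$ right to left; row $t$ vertices are of type $\Theta_t$ with parameter $z_t$. $\mathfrak S^\Theta_{\lambda+\rho}$ is the set of edge labellings with every vertex weight nonzero, top boundary edge of column $\lambda_t+r-t$ carrying $\kappa_t$ ($t=1..r$), other top edges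 and all bottom edges empty, and for each row $t$: if $\Theta_t=\Gamma$ the left boundary edge is empty and the right one occupied, if $\Theta_t=\Delta$ the right one empty and the left one occupied. $\mathrm{wt}(\mathfrak s)(\mathbf z)$ is the product of all vertex weights. Gelfand–Tsetlin patterns: arrays $(a_{i,j})_{0\le i\le j\le r-1}$ of nonnegative integers with $a_{i-1,j-1}\ge a_{i,j}\ge a_{i-1,j}$; $\mathrm{GTP}_\nu$ those with $a_{0,j}=\nu_{j+1}$; row pair $(i-1,i)$ has type $\Gamma$ if $a_{i-1,j-1}>a_{i,j}$ for all $j$ and type $\Delta$ if $a_{i,j}>a_{i-1,j}$ for all $j$; $\mathrm{GTP}^{\Theta'}_\nu$ consists of patterns whose pair $(i-1,i)$ has type $\Theta'_i$ for all $i$. The map $\iota_\Theta:\mathfrak S^\Theta_{\lambda+\rho}\to\mathrm{GTP}^{\Theta'}_{\lambda+\rho}$ sends a state to the pattern whose row $i$ ($0\le i\le r-1$) lists, in decreasing order, the column numbers of the occupied vertical edges directly below lattice row $i$ (for $i=0$: the occupied top boundary edges); it is a bijection. -}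

module Defs where

open import Data.Nat using (ℕ; zero; suc; _+_; _*_; _∸_; _^_; _≤_; _<?_)
open import Data.Nat.ListAction using (sum; product)
open import Data.Fin using (Fin; toℕ; fromℕ; fromℕ<; inject₁; opposite)
  renaming (zero to fz; suc to fs)
open import Data.Fin.Properties using (_≟_) renaming (_≤?_ to _≤F?_; _<?_ to _<F?_)
import Data.Fin as F
open import Data.Maybe using (Maybe; just; nothing)
open import Data.List using (List; []; _∷_; map; allFin)
open import Data.Bool using (Bool; true; false; if_then_else_; _∧_)
open import Data.Product using (_×_)
open import Relation.Nullary using (¬_; does; yes; no)
open import Relation.Binary.PropositionalEquality using (_≡_; _≢_)

-- Palette {c_1 < ... < c_m} is Fin m (c_{i+1} ↔ i, order = Fin order).
-- An edge label is ∅ (nothing) or a colour (just i).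

Label : ℕ → Set
Label m = Maybe (Fin m)

-- Symbolic vertex weights: every Gamma/Delta weight is 0, 1 or z.
data Wt : Set where
  w0 w1 wz : Wt

evalWt : ℕ → Wt → ℕ
evalWt z w0 = 0
evalWt z w1 = 1
evalWt z wz = z

data RowType : Set where
  Γ Δ : RowType

-- Gamma weights; arguments in the order (left, top, right, bottom)
ΓWt : ∀ {m} → Label m → Label m → Label m → Label m → Wt
ΓWt nothing nothing nothing nothing = w1
ΓWt (just i) (just j) (just k) (just l) =
  if does (i ≟ k) ∧ does (j ≟ l)
    then (if does (j ≤F? i) then wz else w0)
    else (if does (i ≟ l) ∧ does (j ≟ k)
            then (if does (i <F? j) then wz else w0)
            else w0)
ΓWt nothing (just j) nothing (just l) = w0
ΓWt (just i) nothing (just k) nothing = if does (i ≟ k) then wz else w0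
ΓWt (just i) nothing nothing (just l) = if does (i ≟ l) then wz else w0
ΓWt nothing (just j) (just k) nothing = if does (j ≟ k) then w1 else w0
ΓWt _ _ _ _ = w0

ΔWt : ∀ {m} → Label m → Label m → Label m → Label m → Wt
ΔWt nothing nothing nothing nothing = wz
ΔWt (just i) (just j) (just k) (just l) =
  if does (i ≟ k) ∧ does (j ≟ l)
    then (if does (i ≤F? j) then w1 else w0)
    else (if does (i ≟ j) ∧ does (k ≟ l)
            then (if does (i <F? k) then w1 else w0)  -- (c_j,c_j,c_i,c_i), weight 1 iff i>j
            else w0)
ΔWt nothing (just j) nothing (just l) = w0
ΔWt (just i) nothing (just k) nothing = if does (i ≟ k) then w1 else w0
ΔWt nothing nothing (just k) (just l) = if does (k ≟ l) then wz else w0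
ΔWt (just i) (just j) nothing nothing = if does (i ≟ j) then w1 else w0
ΔWt _ _ _ _ = w0

vertexWt : ∀ {m} → RowType → Label m → Label m → Label m → Label m → Wt
vertexWt Γ = ΓWt
vertexWt Δ = ΔWt

-- Lattice rows t = 1..r are indexed by Fin r (row t ↔ index t-1).
-- Columns are Fin N; column c has column number toℕ c (numbered right to left).
--  * H t h (h : Fin (suc N)) is the horizontal edge of row t lying to the
--    right of column h (h = 0: right boundary edge; h = N: left boundary edge).
--    Vertex (t,c) has right edge H t c and left edge H t (c+1).
--  * V i c (i : Fin (suc r)) is the vertical edge of column c lying directly
--    below lattice row i (i = 0: top boundary; i = r: bottom boundary).
--    Vertex (row index t, column c) has top edge V t c and bottom edge V (t+1) c.

record Labelling (m r N : ℕ) : Set where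
  field
    H : Fin r → Fin (suc N) → Label m
    V : Fin (suc r) → Fin N → Label m
open Labelling public

vWt : ∀ {m r N} → (Fin r → RowType) → Labelling m r N → Fin r → Fin N → Wt
vWt Θ s t c =
  vertexWt (Θ t) (H s t (fs c)) (V s (inject₁ t) c) (H s t (inject₁ c)) (V s (fs t) c)

occupied : ∀ {m} → Label m → Set
occupied l = l ≢ nothing

-- column of the top boundary carrying κ_t : λ_t + r - t  (t = 1..r)
topColumn : ∀ {r} → (Fin r → ℕ) → Fin r → ℕ
topColumn {r} λ' t = λ' t + (r ∸ suc (toℕ t))

record Admissible {m r N : ℕ} (κ : Fin r → Fin m) (λ' : Fin r → ℕ)
                  (Θ : Fin r → RowType) (s : Labelling m r N) : Set where
  field
    nonzero     : ∀ t c → vWt Θ s t c ≢ w0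
    topκ        : ∀ (c : Fin N) (t : Fin r) → toℕ c ≡ topColumn λ' t → V s fz c ≡ just (κ t)
    topEmpty    : ∀ (c : Fin N) → (∀ t → toℕ c ≢ topColumn λ' t) → V s fz c ≡ nothing
    bottomEmpty : ∀ (c : Fin N) → V s (fromℕ r) c ≡ nothing
    sideΓ       : ∀ t → Θ t ≡ Γ → (H s t (fromℕ N) ≡ nothing) × occupied (H s t fz)
    sideΔ       : ∀ t → Θ t ≡ Δ → (H s t fz ≡ nothing) × occupied (H s t (fromℕ N))

wt : ∀ {m r N} → (Fin r → RowType) → Labelling m r N → (Fin r → ℕ) → ℕ
wt Θ s z = product (map (λ t → product (map (λ c → evalWt (z t) (vWt Θ s t c)) (allFin _))) (allFin _))

-- The map ι_Θ : row i (0 ≤ i ≤ r-1) of the pattern lists, in decreasing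
-- order, the column numbers of the occupied vertical edges directly below
-- lattice row i.

isOcc : ∀ {m} → Label m → Bool
isOcc nothing  = false
isOcc (just _) = true

occupiedDesc : ∀ {m} (n : ℕ) → (Fin n → Label m) → List ℕ
occupiedDesc zero    f = []
occupiedDesc (suc n) f =
  if isOcc (f (fromℕ n)) then n ∷ rest else rest
  where rest = occupiedDesc n (λ c → f (inject₁ c))

ιRow : ∀ {m r N} → Labelling m r N → Fin r → List ℕ
ιRow {N = N} s i = occupiedDesc N (V s (inject₁ i))

d : ∀ {m r N} → Labelling m r N → Fin (suc r) → ℕ
d {r = r} s i with toℕ i <? r
... | yes p = sum (ιRow s (fromℕ< p))
... | no  _ = 0

-- wt(𝔗) = (d_{r-1}, d_{r-2} - d_{r-1}, ..., d_0 - d_1)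
-- (entry k, 0-indexed, is d_{r-1-k} - d_{r-k})
wtGT : ∀ {m r N} → Labelling m r N → Fin r → ℕ
wtGT s k = d s (inject₁ (opposite k)) ∸ d s (fs (opposite k))

w₀ : ∀ {r} {A : Set} → (Fin r → A) → (Fin r → A)
w₀ v k = v (opposite k)

zmono : ∀ {r} → (Fin r → ℕ) → (Fin r → ℕ) → ℕ
zmono z e = product (map (λ t → z t ^ e t) (allFin _))

-- A vertex of nonzero weight in a row of type θ has weight z^δ(left), where
-- δ = zDegree θ is 1 exactly on occupied edges (θ = Γ) resp. empty edges
-- (θ = Δ), and δ(left) + [top occupied] = δ(right) + [bottom occupied].
-- Weighting this conservation law in column c by c and summing along row t
-- (summation by parts) shows that the z_t-degree of the row is the sum of the
-- column numbers of the occupied edges above it minus those below it, i.e.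
-- d_{t-1} − d_t, because the boundary conditions make δ vanish on the left
-- boundary edge.  The reversal w₀ undoes the reversal built into wt(𝔗).
module Submission where

open import Defs
open import Data.Nat using (ℕ; _+_; _^_; _∸_; _≤_)
open import Data.Nat.ListAction using (product)
open import Data.Fin using (Fin; inject₁; suc; _≤_)
open import Data.List using (map; allFin)
open import Data.Product using (_×_)
open import Relation.Binary.PropositionalEquality using (_≡_)

open import Data.Bool using (true; false; if_then_else_; _∧_)
open import Data.Empty using (⊥-elim)
open import Data.Fin using (zero; toℕ; fromℕ; fromℕ<)
open import Data.Fin.Properties
  using (_≟_; _≤?_; _<?_; toℕ-inject₁; toℕ-fromℕ; toℕ-fromℕ<; toℕ-injective; toℕ<n;
         opposite-involutive)
open import Data.List using (List; []; _∷_; tabulate)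
open import Data.List.Properties using (map-cong; map-tabulate)
open import Data.Maybe using (just; nothing)
open import Data.Nat using (zero; suc; _*_; s≤s⁻¹)
open import Data.Nat.ListAction using (sum)
open import Data.Nat.Properties
  using (+-0-monoid; +-identityʳ; *-zeroʳ; *-identityʳ; +-comm; ^-distribˡ-+-*;
         m+n∸n≡m; ≤-antisym; ≮⇒≥)
open import Data.Nat.Tactic.RingSolver using (solve)
open import Algebra.Properties.Monoid.Sum +-0-monoid
  using (sum-syntax; sum-cong-≗; sum-init-last; sum-replicate-zero)
open import Data.Product using (_,_; proj₁; proj₂)
open import Function using (id; _∘_)
open import Relation.Binary.PropositionalEquality
  using (_≢_; refl; sym; trans; cong; cong₂; module ≡-Reasoning)
open import Relation.Nullary using (does; yes; no)

open ≡-Reasoning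

product-map-^ : ∀ {A : Set} (x : ℕ) (e : A → ℕ) (as : List A) →
  product (map (λ a → x ^ e a) as) ≡ x ^ sum (map e as)
product-map-^ x e []       = refl
product-map-^ x e (a ∷ as) = begin
  x ^ e a * product (map (λ a → x ^ e a) as) ≡⟨ cong (x ^ e a *_) (product-map-^ x e as) ⟩
  x ^ e a * x ^ sum (map e as)               ≡⟨ ^-distribˡ-+-* x (e a) _ ⟨
  x ^ (e a + sum (map e as))                 ∎

sum-map-allFin : ∀ n (f : Fin n → ℕ) → sum (map f (allFin n)) ≡ ∑[ c < n ] f c
sum-map-allFin n f = trans (cong sum (map-tabulate id f)) (sum-tabulate n f)
  where
  sum-tabulate : ∀ n (f : Fin n → ℕ) → sum (tabulate f) ≡ ∑[ c < n ] f c
  sum-tabulate zero    f = refl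
  sum-tabulate (suc n) f = cong (f zero +_) (sum-tabulate n (f ∘ suc))

∑-weighted-init-last : ∀ n (g : Fin (suc n) → ℕ) →
  ∑[ c < suc n ] (toℕ c * g c) ≡ ∑[ c < n ] (toℕ c * g (inject₁ c)) + n * g (fromℕ n)
∑-weighted-init-last n g = begin
  ∑[ c < suc n ] (toℕ c * g c)
    ≡⟨ sum-init-last (λ c → toℕ c * g c) ⟩
  ∑[ c < n ] (toℕ (inject₁ c) * g (inject₁ c)) + toℕ (fromℕ n) * g (fromℕ n)
    ≡⟨ cong₂ _+_ (sum-cong-≗ (λ c → cong (_* g (inject₁ c)) (toℕ-inject₁ c)))
                 (cong (_* g (fromℕ n)) (toℕ-fromℕ n)) ⟩
  ∑[ c < n ] (toℕ c * g (inject₁ c)) + n * g (fromℕ n) ∎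

summation-by-parts : ∀ n (h : Fin (suc n) → ℕ) (T B : Fin n → ℕ) →
  (∀ c → h (suc c) + T c ≡ h (inject₁ c) + B c) →
  ∑[ c < n ] h (suc c) + ∑[ c < n ] (toℕ c * B c) ≡ ∑[ c < n ] (toℕ c * T c) + n * h (fromℕ n)
summation-by-parts zero    h T B conserved = refl
summation-by-parts (suc n) h T B conserved = begin
  ∑[ c < suc n ] h (suc c) + ∑[ c < suc n ] (toℕ c * B c)
    ≡⟨ cong₂ _+_ (sum-init-last (h ∘ suc)) (∑-weighted-init-last n B) ⟩
  (∑[ c < n ] h (suc (inject₁ c)) + h (fromℕ (suc n)))
    + (∑[ c < n ] (toℕ c * B (inject₁ c)) + n * B (fromℕ n))
    ≡⟨ by-parts-step ∑H ∑B ∑T n (h (inject₁ (fromℕ n))) (h (fromℕ (suc n))) (B (fromℕ n)) (T (fromℕ n))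
            (summation-by-parts n (h ∘ inject₁) (T ∘ inject₁) (B ∘ inject₁) (conserved ∘ inject₁))
            (conserved (fromℕ n)) ⟩
  (∑[ c < n ] (toℕ c * T (inject₁ c)) + n * T (fromℕ n)) + suc n * h (fromℕ (suc n))
    ≡⟨ cong (_+ suc n * h (fromℕ (suc n))) (∑-weighted-init-last n T) ⟨
  ∑[ c < suc n ] (toℕ c * T c) + suc n * h (fromℕ (suc n)) ∎
  where
  ∑H ∑B ∑T : ℕ
  ∑H = ∑[ c < n ] h (suc (inject₁ c))
  ∑B = ∑[ c < n ] (toℕ c * B (inject₁ c))
  ∑T = ∑[ c < n ] (toℕ c * T (inject₁ c))
  by-parts-step : ∀ H B′ T′ n h h′ b t → H + B′ ≡ T′ + n * h → h′ + t ≡ h + b →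
         (H + h′) + (B′ + n * b) ≡ (T′ + n * t) + suc n * h′
  by-parts-step H B′ T′ n h h′ b t ih conserved = begin
    (H + h′) + (B′ + n * b)    ≡⟨ solve (H ∷ h′ ∷ B′ ∷ n ∷ b ∷ []) ⟩
    (H + B′) + (h′ + n * b)    ≡⟨ cong (_+ (h′ + n * b)) ih ⟩
    (T′ + n * h) + (h′ + n * b) ≡⟨ solve (T′ ∷ n ∷ h ∷ h′ ∷ b ∷ []) ⟩
    T′ + h′ + n * (h + b)      ≡⟨ cong (λ x → T′ + h′ + n * x) conserved ⟨
    T′ + h′ + n * (h′ + t)     ≡⟨ solve (T′ ∷ h′ ∷ n ∷ t ∷ []) ⟩
    (T′ + n * t) + suc n * h′  ∎

occ : ∀ {m} → Label m → ℕ
occ nothing  = 0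
occ (just _) = 1

zDegree : ∀ {m} → RowType → Label m → ℕ
zDegree Γ l        = occ l
zDegree Δ nothing  = 1
zDegree Δ (just _) = 0

IsMonomial : ℕ → Wt → Set
IsMonomial e w = ∀ z → evalWt z w ≡ z ^ e

record VertexLaws {m} (θ : RowType) (l t r b : Label m) : Set where
  constructor laws
  field
    weight-monomial : IsMonomial (zDegree θ l) (vertexWt θ l t r b)
    flux-conserved  : zDegree θ l + occ t ≡ zDegree θ r + occ b
open VertexLaws

w1-monomial : IsMonomial 0 w1
w1-monomial z = refl

wz-monomial : IsMonomial 1 wz
wz-monomial z = sym (*-identityʳ z)

if-wz-monomial : ∀ b → (if b then wz else w0) ≢ w0 → IsMonomial 1 (if b then wz else w0)
if-wz-monomial true  _   = wz-monomial
if-wz-monomial false ≢w0 = ⊥-elim (≢w0 refl)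

if-w1-monomial : ∀ b → (if b then w1 else w0) ≢ w0 → IsMonomial 0 (if b then w1 else w0)
if-w1-monomial true  _   = w1-monomial
if-w1-monomial false ≢w0 = ⊥-elim (≢w0 refl)

Γ-coloured-monomial : ∀ {m} (i j k l : Fin m) → ΓWt (just i) (just j) (just k) (just l) ≢ w0 →
  IsMonomial 1 (ΓWt (just i) (just j) (just k) (just l))
Γ-coloured-monomial i j k l ≢w0
  with does (i ≟ k) ∧ does (j ≟ l) | does (j ≤? i) | does (i ≟ l) ∧ does (j ≟ k) | does (i <? j)
... | true  | true  | _     | _     = wz-monomial
... | false | _     | true  | true  = wz-monomial
... | true  | false | _     | _     = ⊥-elim (≢w0 refl)
... | false | _     | true  | false = ⊥-elim (≢w0 refl)
... | false | _     | false | _     = ⊥-elim (≢w0 refl)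

Γ-vertexLaws : ∀ {m} (l t r b : Label m) → ΓWt l t r b ≢ w0 → VertexLaws Γ l t r b
Γ-vertexLaws nothing  nothing  nothing  nothing  _   = laws w1-monomial refl
Γ-vertexLaws (just i) (just j) (just k) (just l) ≢w0 = laws (Γ-coloured-monomial i j k l ≢w0) refl
Γ-vertexLaws (just _) nothing  (just _) nothing  ≢w0 = laws (if-wz-monomial _ ≢w0) refl
Γ-vertexLaws (just _) nothing  nothing  (just _) ≢w0 = laws (if-wz-monomial _ ≢w0) refl
Γ-vertexLaws nothing  (just _) (just _) nothing  ≢w0 = laws (if-w1-monomial _ ≢w0) refl
Γ-vertexLaws nothing  nothing  nothing  (just _) ≢w0 = ⊥-elim (≢w0 refl)
Γ-vertexLaws nothing  nothing  (just _) nothing  ≢w0 = ⊥-elim (≢w0 refl)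
Γ-vertexLaws nothing  nothing  (just _) (just _) ≢w0 = ⊥-elim (≢w0 refl)
Γ-vertexLaws nothing  (just _) nothing  nothing  ≢w0 = ⊥-elim (≢w0 refl)
Γ-vertexLaws nothing  (just _) nothing  (just _) ≢w0 = ⊥-elim (≢w0 refl)
Γ-vertexLaws nothing  (just _) (just _) (just _) ≢w0 = ⊥-elim (≢w0 refl)
Γ-vertexLaws (just _) nothing  nothing  nothing  ≢w0 = ⊥-elim (≢w0 refl)
Γ-vertexLaws (just _) nothing  (just _) (just _) ≢w0 = ⊥-elim (≢w0 refl)
Γ-vertexLaws (just _) (just _) nothing  nothing  ≢w0 = ⊥-elim (≢w0 refl)
Γ-vertexLaws (just _) (just _) nothing  (just _) ≢w0 = ⊥-elim (≢w0 refl)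
Γ-vertexLaws (just _) (just _) (just _) nothing  ≢w0 = ⊥-elim (≢w0 refl)

Δ-coloured-monomial : ∀ {m} (i j k l : Fin m) → ΔWt (just i) (just j) (just k) (just l) ≢ w0 →
  IsMonomial 0 (ΔWt (just i) (just j) (just k) (just l))
Δ-coloured-monomial i j k l ≢w0
  with does (i ≟ k) ∧ does (j ≟ l) | does (i ≤? j) | does (i ≟ j) ∧ does (k ≟ l) | does (i <? k)
... | true  | true  | _     | _     = w1-monomial
... | false | _     | true  | true  = w1-monomial
... | true  | false | _     | _     = ⊥-elim (≢w0 refl)
... | false | _     | true  | false = ⊥-elim (≢w0 refl)
... | false | _     | false | _     = ⊥-elim (≢w0 refl)

Δ-vertexLaws : ∀ {m} (l t r b : Label m) → ΔWt l t r b ≢ w0 → VertexLaws Δ l t r b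
Δ-vertexLaws nothing  nothing  nothing  nothing  _   = laws wz-monomial refl
Δ-vertexLaws (just i) (just j) (just k) (just l) ≢w0 = laws (Δ-coloured-monomial i j k l ≢w0) refl
Δ-vertexLaws (just _) nothing  (just _) nothing  ≢w0 = laws (if-w1-monomial _ ≢w0) refl
Δ-vertexLaws nothing  nothing  (just _) (just _) ≢w0 = laws (if-wz-monomial _ ≢w0) refl
Δ-vertexLaws (just _) (just _) nothing  nothing  ≢w0 = laws (if-w1-monomial _ ≢w0) refl
Δ-vertexLaws nothing  nothing  nothing  (just _) ≢w0 = ⊥-elim (≢w0 refl)
Δ-vertexLaws nothing  nothing  (just _) nothing  ≢w0 = ⊥-elim (≢w0 refl)
Δ-vertexLaws nothing  (just _) nothing  nothing  ≢w0 = ⊥-elim (≢w0 refl)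
Δ-vertexLaws nothing  (just _) nothing  (just _) ≢w0 = ⊥-elim (≢w0 refl)
Δ-vertexLaws nothing  (just _) (just _) nothing  ≢w0 = ⊥-elim (≢w0 refl)
Δ-vertexLaws nothing  (just _) (just _) (just _) ≢w0 = ⊥-elim (≢w0 refl)
Δ-vertexLaws (just _) nothing  nothing  nothing  ≢w0 = ⊥-elim (≢w0 refl)
Δ-vertexLaws (just _) nothing  nothing  (just _) ≢w0 = ⊥-elim (≢w0 refl)
Δ-vertexLaws (just _) nothing  (just _) (just _) ≢w0 = ⊥-elim (≢w0 refl)
Δ-vertexLaws (just _) (just _) nothing  (just _) ≢w0 = ⊥-elim (≢w0 refl)
Δ-vertexLaws (just _) (just _) (just _) nothing  ≢w0 = ⊥-elim (≢w0 refl)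

vertexLaws : ∀ {m} θ (l t r b : Label m) → vertexWt θ l t r b ≢ w0 → VertexLaws θ l t r b
vertexLaws Γ = Γ-vertexLaws
vertexLaws Δ = Δ-vertexLaws

occupiedColumnSum : ∀ {m n} → (Fin n → Label m) → ℕ
occupiedColumnSum {n = n} f = ∑[ c < n ] (toℕ c * occ (f c))

occupiedColumnSum-empty : ∀ {m n} (f : Fin n → Label m) → (∀ c → f c ≡ nothing) →
  occupiedColumnSum f ≡ 0
occupiedColumnSum-empty {n = n} f empty = trans
  (sum-cong-≗ (λ c → trans (cong (λ l → toℕ c * occ l) (empty c)) (*-zeroʳ (toℕ c))))
  (sum-replicate-zero n)

sum-occupiedDesc : ∀ {m} n (f : Fin n → Label m) →
  sum (occupiedDesc n f) ≡ occupiedColumnSum f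
sum-occupiedDesc zero    f = refl
sum-occupiedDesc (suc n) f = begin
  sum (occupiedDesc (suc n) f)
    ≡⟨ sum-if-cons (f (fromℕ n)) ⟩
  sum (occupiedDesc n (f ∘ inject₁)) + n * occ (f (fromℕ n))
    ≡⟨ cong (_+ n * occ (f (fromℕ n))) (sum-occupiedDesc n (f ∘ inject₁)) ⟩
  occupiedColumnSum (f ∘ inject₁) + n * occ (f (fromℕ n))
    ≡⟨ ∑-weighted-init-last n (occ ∘ f) ⟨
  occupiedColumnSum f ∎
  where
  rest : List ℕ
  rest = occupiedDesc n (f ∘ inject₁)
  sum-if-cons : ∀ l → sum (if isOcc l then n ∷ rest else rest) ≡ sum rest + n * occ l
  sum-if-cons nothing  = sym (trans (cong (sum rest +_) (*-zeroʳ n)) (+-identityʳ _))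
  sum-if-cons (just _) = trans (+-comm n _) (cong (sum rest +_) (sym (*-identityʳ n)))

d≡occupiedColumnSum : ∀ {m r N} (s : Labelling m r N) → (∀ c → V s (fromℕ r) c ≡ nothing) →
  ∀ i → d s i ≡ occupiedColumnSum (V s i)
d≡occupiedColumnSum {r = r} {N} s bottomEmpty i with toℕ i Data.Nat.<? r
... | yes i<r = trans (sum-occupiedDesc N _) (cong (occupiedColumnSum ∘ V s) inject₁-fromℕ<)
  where
  inject₁-fromℕ< : inject₁ (fromℕ< i<r) ≡ i
  inject₁-fromℕ< = toℕ-injective (trans (toℕ-inject₁ _) (toℕ-fromℕ< i<r))
... | no  i≮r = sym (trans (cong (occupiedColumnSum ∘ V s) i≡r)
                           (occupiedColumnSum-empty _ bottomEmpty))
  where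
  i≡r : i ≡ fromℕ r
  i≡r = toℕ-injective (trans (≤-antisym (s≤s⁻¹ (toℕ<n i)) (≮⇒≥ i≮r)) (sym (toℕ-fromℕ r)))

module _ {m r N : ℕ} {κ : Fin r → Fin m} {λ' : Fin r → ℕ} (Θ : Fin r → RowType)
         (s : Labelling m r N) (adm : Admissible κ λ' Θ s) where
  open Admissible adm

  vertex-laws : ∀ t c →
    VertexLaws (Θ t) (H s t (suc c)) (V s (inject₁ t) c) (H s t (inject₁ c)) (V s (suc t) c)
  vertex-laws t c = vertexLaws (Θ t) _ _ _ _ (nonzero t c)

  leftBoundary-zDegree : ∀ t → zDegree (Θ t) (H s t (fromℕ N)) ≡ 0
  leftBoundary-zDegree t with Θ t in Θt
  ... | Γ = cong occ (proj₁ (sideΓ t Θt))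
  ... | Δ with H s t (fromℕ N) | proj₂ (sideΔ t Θt)
  ...   | nothing | left-occupied = ⊥-elim (left-occupied refl)
  ...   | just _  | _             = refl

  row-zDegree : ∀ t → ∑[ c < N ] zDegree (Θ t) (H s t (suc c)) ≡ d s (inject₁ t) ∸ d s (suc t)
  row-zDegree t = begin
    ∑h                            ≡⟨ m+n∸n≡m ∑h below ⟨
    (∑h + below) ∸ below          ≡⟨ cong₂ _∸_ flux (sym (d≡occupiedColumnSum s bottomEmpty (suc t))) ⟩
    d s (inject₁ t) ∸ d s (suc t) ∎
    where
    h : Fin (suc N) → ℕ
    h k = zDegree (Θ t) (H s t k)
    ∑h below above : ℕ
    ∑h    = ∑[ c < N ] h (suc c)
    below = occupiedColumnSum (V s (suc t))
    above = occupiedColumnSum (V s (inject₁ t))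
    flux : ∑h + below ≡ d s (inject₁ t)
    flux = begin
      ∑h + below              ≡⟨ summation-by-parts N h _ _ (flux-conserved ∘ vertex-laws t) ⟩
      above + N * h (fromℕ N) ≡⟨ cong (λ x → above + N * x) (leftBoundary-zDegree t) ⟩
      above + N * 0           ≡⟨ cong (above +_) (*-zeroʳ N) ⟩
      above + 0               ≡⟨ +-identityʳ above ⟩
      above                   ≡⟨ d≡occupiedColumnSum s bottomEmpty (inject₁ t) ⟨
      d s (inject₁ t)         ∎

  row-weight : (z : Fin r → ℕ) → ∀ t →
    product (map (λ c → evalWt (z t) (vWt Θ s t c)) (allFin N)) ≡ z t ^ (d s (inject₁ t) ∸ d s (suc t))
  row-weight z t = begin
    product (map (λ c → evalWt (z t) (vWt Θ s t c)) (allFin N))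
      ≡⟨ cong product (map-cong (λ c → weight-monomial (vertex-laws t c) (z t)) (allFin N)) ⟩
    product (map (λ c → z t ^ zDegree (Θ t) (H s t (suc c))) (allFin N))
      ≡⟨ product-map-^ (z t) _ (allFin N) ⟩
    z t ^ sum (map (λ c → zDegree (Θ t) (H s t (suc c))) (allFin N))
      ≡⟨ cong (z t ^_) (trans (sum-map-allFin N _) (row-zDegree t)) ⟩
    z t ^ (d s (inject₁ t) ∸ d s (suc t)) ∎

proposition4p3 : (m r N : ℕ) (κ : Fin r → Fin m) (λ' : Fin r → ℕ) →
    (∀ i j → i Data.Fin.≤ j → λ' j Data.Nat.≤ λ' i) →
    (∀ t → λ' t + r Data.Nat.≤ N) →
    (Θ : Fin r → RowType) (s : Labelling m r N) → Admissible κ λ' Θ s →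
    (z : Fin r → ℕ) →
      (wt Θ s z ≡ zmono z (w₀ (wtGT s)))
      × (zmono z (w₀ (wtGT s))
           ≡ product (map (λ t → z t ^ (d s (inject₁ t) ∸ d s (suc t))) (allFin r)))
proposition4p3 m r N κ λ' _ _ Θ s adm z = trans rows (sym reversal) , reversal
  where
  e : Fin r → ℕ
  e t = d s (inject₁ t) ∸ d s (suc t)
  rows : wt Θ s z ≡ product (map (λ t → z t ^ e t) (allFin r))
  rows = cong product (map-cong (row-weight Θ s adm z) (allFin r))
  reversal : zmono z (w₀ (wtGT s)) ≡ product (map (λ t → z t ^ e t) (allFin r))
  reversal = cong product (map-cong (λ t → cong (λ u → z t ^ e u) (opposite-involutive t)) (allFin r))
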